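{- Let $q$ be any prime power and let $t,t'\in\mathbb F_q^*$. If $\frac{X^3+X^2+t}{X}$ and $\frac{X^3+X^2+t'}{X}$ are equivalent, then $t=t'$.
   Context: $\mathbb F_q$ is the field with $q$ elements. $\mathrm{PGL}(2,\mathbb F_q)$ is the group (under composition) of rational functions $(aX+b)/(cX+d)$, $a,b,c,d\in\mathbb F_q$, $ad-bc\neq0$. Two nonconstant $f,g\in\mathbb F_q(X)$ are equivalent if $g=\psi\circ f\circ\phi$ for some $\psi,\phi\in\mathrm{PGL}(2,\mathbb F_q)$. -}

module Defs where

open import Level using (Level; _⊔_)
open import Algebra.Bundles using (CommutativeRing)
open import Data.Nat as ℕ using (ℕ; zero; suc; _∸_)
open import Data.Nat.Primality using (Prime)
open import Data.Fin using (Fin)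
open import Data.List using (List; []; _∷_; length)
open import Data.Product using (Σ; ∃; ∃-syntax; _×_; _,_)
open import Relation.Binary.PropositionalEquality using (_≡_)
open import Relation.Nullary using (¬_)

IsPrimePower : ℕ → Set
IsPrimePower q = ∃[ p ] ∃[ k ] (Prime p × q ≡ p ℕ.^ suc k)

record IsFiniteField {c ℓ : Level} (R : CommutativeRing c ℓ) (q : ℕ) : Set (c ⊔ ℓ) where
  open CommutativeRing R
  field
    1≉0      : ¬ (1# ≈ 0#)
    inverse  : ∀ x → ¬ (x ≈ 0#) → ∃[ y ] (x * y ≈ 1#)
    enum     : Fin q → Carrier
    enum-inj : ∀ i j → enum i ≈ enum j → i ≡ j
    enum-sur : ∀ x → ∃[ i ] (enum i ≈ x)

module Poly {c ℓ : Level} (R : CommutativeRing c ℓ) where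
  open CommutativeRing R

  -- a polynomial is its coefficient list  [a₀, a₁, …]  (a₀ + a₁ X + …)
  Pol : Set c
  Pol = List Carrier

  coeff : Pol → ℕ → Carrier
  coeff []       _       = 0#
  coeff (a ∷ p)  zero    = a
  coeff (a ∷ p)  (suc i) = coeff p i

  _≈ₚ_ : Pol → Pol → Set ℓ
  p ≈ₚ r = ∀ i → coeff p i ≈ coeff r i

  infixl 6 _+ₚ_
  infixl 7 _*ₚ_ _·ₚ_

  _+ₚ_ : Pol → Pol → Pol
  []      +ₚ r       = r
  (a ∷ p) +ₚ []      = a ∷ p
  (a ∷ p) +ₚ (b ∷ r) = (a + b) ∷ (p +ₚ r)

  _·ₚ_ : Carrier → Pol → Pol
  a ·ₚ []      = []
  a ·ₚ (b ∷ p) = (a * b) ∷ (a ·ₚ p)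

  _*ₚ_ : Pol → Pol → Pol
  []      *ₚ r = []
  (a ∷ p) *ₚ r = (a ·ₚ r) +ₚ (0# ∷ (p *ₚ r))

  constₚ : Carrier → Pol
  constₚ a = a ∷ []

  _^ₚ_ : Pol → ℕ → Pol
  p ^ₚ zero  = constₚ 1#
  p ^ₚ suc n = p *ₚ (p ^ₚ n)

  lin : Carrier → Carrier → Pol
  lin a b = b ∷ a ∷ []

  record RatFun : Set (c ⊔ ℓ) where
    constructor _/_∣_
    field
      num   : Pol
      den   : Pol
      den≠0 : ¬ (den ≈ₚ [])
  open RatFun public

  _≈ᵣ_ : RatFun → RatFun → Set ℓ
  f ≈ᵣ g = (num f *ₚ den g) ≈ₚ (num g *ₚ den f)

  -- an element (aX+b)/(cX+d) of PGL(2,R): ad - bc ≠ 0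
  record Möbius : Set (c ⊔ ℓ) where
    field
      a b c' d : Carrier
      det≠0    : ¬ (a * d - b * c' ≈ 0#)
  open Möbius public

  hsubst : ℕ → Pol → Pol → Pol → Pol
  hsubst m p r s = go 0 p
    where
      go : ℕ → Pol → Pol
      go i []      = []
      go i (a ∷ p) = (a ·ₚ ((r ^ₚ i) *ₚ (s ^ₚ (m ∸ i)))) +ₚ go (suc i) p

  postcomp : Möbius → RatFun → Pol × Pol
  postcomp ψ f = ((a ψ ·ₚ num f) +ₚ (b ψ ·ₚ den f)) , ((c' ψ ·ₚ num f) +ₚ (d ψ ·ₚ den f))

  -- (N/D) ∘ φ  with φ = (aX+b)/(cX+d): multiply numerator and denominator by (cX+d)^m
  precomp : Pol × Pol → Möbius → Pol × Pol
  precomp (N , D) φ =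
    hsubst m N (lin (a φ) (b φ)) (lin (c' φ) (d φ)) ,
    hsubst m D (lin (a φ) (b φ)) (lin (c' φ) (d φ))
    where m = length N ℕ.⊔ length D

  _≈ᵣ'_ : RatFun → Pol × Pol → Set ℓ
  g ≈ᵣ' (N , D) = (num g *ₚ D) ≈ₚ (N *ₚ den g)

  Equivalent : RatFun → RatFun → Set (c ⊔ ℓ)
  Equivalent f g = ∃[ ψ ] ∃[ φ ] (g ≈ᵣ' precomp (postcomp ψ f) φ)

  X≠0 : ¬ (1# ≈ 0#) → ¬ ((0# ∷ 1# ∷ []) ≈ₚ [])
  X≠0 1≉0 h = 1≉0 (h 1)

  fₜ : ¬ (1# ≈ 0#) → Carrier → RatFun
  fₜ 1≉0 t = (t ∷ 0# ∷ 1# ∷ 1# ∷ []) / (0# ∷ 1# ∷ []) ∣ X≠0 1≉0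

module Submission where

open import Defs
open import Level using (Level)
open import Algebra.Bundles using (CommutativeRing)
open import Data.Fin using (Fin; #_)
open import Data.Fin.Properties using (≡-setoid; inj⇒≟)
open import Data.List using (List; []; _∷_)
open import Data.Nat using (ℕ; zero; suc; _∸_)
open import Data.Product using (_×_; _,_; proj₁; proj₂; ∃-syntax)
open import Data.Vec using (Vec; _∷_; [])
open import Function using (_∘_)
open import Function.Bundles using (Injection)
open import Relation.Binary.Definitions using (Decidable)
import Relation.Binary.PropositionalEquality as ≡
open import Relation.Nullary using (¬_; yes; no)

-- Write φ = (αX + β)/(γX + δ) and let P/Q be fₜ ∘ φ, homogenised in degree 3.
-- Clearing denominators in fᵤ = ψ ∘ fₜ ∘ φ and cancelling the common factor
-- γX + δ gives (X³ + X² + u)·D = X·N, where N/D = ψ ∘ (P/Q). Comparing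
-- coefficients (u ≠ 0) puts N and D, and hence, ψ being invertible, P and Q,
-- in the span of X³ + X² + u and X. For P and Q = (αX + β)(γX + δ)² these are
-- four polynomial equations in α, β, γ, δ, t, u. If γ = 0 they force β = 0,
-- α = δ and then t = u. If γ ≠ 0 they give βγ = α(γ − 2δ), tγ³ = α²(2α + γ),
-- uγ³ = δ²(γ − 2δ) and finally α + δ = 0, so that tγ³ = uγ³.

module _ {c ℓ : Level} (R : CommutativeRing c ℓ) where

  open CommutativeRing R
  open Poly R
  open import Algebra.Definitions _≈_ using (AlmostLeftCancellative)
  open import Algebra.Properties.AbelianGroup +-abelianGroup
    using (∙-cancelʳ; //-rightDividesˡ; x∙y⁻¹≈ε⇒x≈y; x≈y⇒x∙y⁻¹≈ε)
  open import Algebra.Solver.Ring.NaturalCoefficients.Default commutativeSemiring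
    using (Polynomial; var; con; _:+_; _:*_; _:^_; _:=_; ⟦_⟧; ⟦_⟧↓; solve; prove)
  open import Relation.Binary.Reasoning.Setoid setoid

  -- The ring solver used here has coefficients in ℕ, so linear combinations of
  -- equations are taken without subtraction: a ≈ b adds up multiples of
  -- hypotheses (with _⟨+⟩_ below) and x + b ≈ y + a is checked by the solver.
  x+b≈y+a⇒x≈y : ∀ {x y a b} → a ≈ b → x + b ≈ y + a → x ≈ y
  x+b≈y+a⇒x≈y {a = a} a≈b x+b≈y+a = ∙-cancelʳ a _ _ (trans (+-congˡ a≈b) x+b≈y+a)

  infixl 6 _⟨+⟩_
  _⟨+⟩_ : ∀ {x y u v} → x ≈ y → u ≈ v → x + u ≈ y + v
  _⟨+⟩_ = +-cong

  coeff-+ₚ : ∀ p r i → coeff (p +ₚ r) i ≈ coeff p i + coeff r i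
  coeff-+ₚ []      r       i       = sym (+-identityˡ _)
  coeff-+ₚ (a ∷ p) []      i       = sym (+-identityʳ _)
  coeff-+ₚ (a ∷ p) (b ∷ r) zero    = refl
  coeff-+ₚ (a ∷ p) (b ∷ r) (suc i) = coeff-+ₚ p r i

  coeff-·ₚ : ∀ a p i → coeff (a ·ₚ p) i ≈ a * coeff p i
  coeff-·ₚ a []      i       = sym (zeroʳ a)
  coeff-·ₚ a (b ∷ p) zero    = refl
  coeff-·ₚ a (b ∷ p) (suc i) = coeff-·ₚ a p i

  coeff-lincomb : ∀ a b p r i → coeff (a ·ₚ p +ₚ b ·ₚ r) i ≈ a * coeff p i + b * coeff r i
  coeff-lincomb a b p r i =
    trans (coeff-+ₚ (a ·ₚ p) (b ·ₚ r) i) (+-cong (coeff-·ₚ a p i) (coeff-·ₚ b r i))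

  coeff-lin-*ₚ : ∀ γ δ p i → coeff (lin γ δ *ₚ p) i ≈ δ * coeff p i + γ * coeff (0# ∷ p) i
  coeff-lin-*ₚ γ δ p i = begin
    coeff (lin γ δ *ₚ p) i                ≈⟨ coeff-+ₚ (δ ·ₚ p) (0# ∷ γp) i ⟩
    coeff (δ ·ₚ p) i + coeff (0# ∷ γp) i  ≈⟨ +-cong (coeff-·ₚ δ p i) (shifted i) ⟩
    δ * coeff p i + γ * coeff (0# ∷ p) i  ∎
    where
    γp : Pol
    γp = γ ·ₚ p +ₚ (0# ∷ [])
    coeff-0∷[] : ∀ i → coeff (0# ∷ []) i ≈ 0#
    coeff-0∷[] zero    = refl
    coeff-0∷[] (suc i) = refl
    shifted : ∀ i → coeff (0# ∷ γp) i ≈ γ * coeff (0# ∷ p) i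
    shifted zero    = sym (zeroʳ γ)
    shifted (suc i) = begin
      coeff γp i                            ≈⟨ coeff-+ₚ (γ ·ₚ p) (0# ∷ []) i ⟩
      coeff (γ ·ₚ p) i + coeff (0# ∷ []) i  ≈⟨ +-cong (coeff-·ₚ γ p i) (coeff-0∷[] i) ⟩
      γ * coeff p i + 0#                    ≈⟨ +-identityʳ _ ⟩
      γ * coeff p i                         ∎

  Möbius-nonsingular : ∀ m → ¬ a m * d m ≈ b m * c' m
  Möbius-nonsingular m ad≈bc = det≠0 m (x≈y⇒x∙y⁻¹≈ε ad≈bc)

  Möbius-denominator≉0 : ∀ m → ¬ lin (c' m) (d m) ≈ₚ []
  Möbius-denominator≉0 m lin≈0 = Möbius-nonsingular m (begin
    a m * d m   ≈⟨ *-congˡ (lin≈0 0) ⟩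
    a m * 0#    ≈⟨ zeroʳ _ ⟩
    0#          ≈⟨ zeroʳ _ ⟨
    b m * 0#    ≈⟨ *-congˡ (lin≈0 1) ⟨
    b m * c' m  ∎)

  IsFiniteField⇒≟ : ∀ {q} → IsFiniteField R q → Decidable _≈_
  IsFiniteField⇒≟ {q} F = inj⇒≟ index-injection
    where
    open IsFiniteField F
    index : Carrier → Fin q
    index x = proj₁ (enum-sur x)
    enum-index : ∀ x → enum (index x) ≈ x
    enum-index x = proj₂ (enum-sur x)
    index-injection : Injection setoid (≡-setoid q)
    index-injection = record
      { to        = index
      ; cong      = λ {x} {y} x≈y →
          enum-inj _ _ (trans (enum-index x) (trans x≈y (sym (enum-index y))))
      ; injective = λ {x} {y} ix≡iy →
          trans (sym (enum-index x)) (trans (reflexive (≡.cong enum ix≡iy)) (enum-index y))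
      }

  cubic : Carrier → Pol
  cubic t = t ∷ 0# ∷ 1# ∷ 1# ∷ []

  X : Pol
  X = 0# ∷ 1# ∷ []

  -- For p of degree at most 3: p is a linear combination of X³ + X² + u and X.
  record InSpan (u : Carrier) (p : Pol) : Set ℓ where
    field
      coeff₃≈coeff₂   : coeff p 3 ≈ coeff p 2
      coeff₀≈u*coeff₃ : coeff p 0 ≈ u * coeff p 3

  -- fₜ ∘ φ for φ = (αX + β)/(γX + δ), homogenised in degree 3:
  -- (αX + β)³ + (αX + β)²(γX + δ) + t(γX + δ)³ over (αX + β)(γX + δ)².
  fₜ∘φ-num : (t α β γ δ : Carrier) → Pol
  fₜ∘φ-num t α β γ δ = hsubst 3 (cubic t) (lin α β) (lin γ δ)

  fₜ∘φ-den : (α β γ δ : Carrier) → Pol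
  fₜ∘φ-den α β γ δ = hsubst 3 X (lin α β) (lin γ δ)

  -- On lists of known
  -- length the semantics of a syntactic coefficient unfolds to the same term as
  -- the corresponding coeff, so the solver can normalise coefficients of products.
  module Syntax {n : ℕ} where

    infixl 6 _+ₛ_
    infixl 7 _*ₛ_ _·ₛ_

    Polₛ : Set
    Polₛ = List (Polynomial n)

    _+ₛ_ : Polₛ → Polₛ → Polₛ
    []      +ₛ r       = r
    (x ∷ p) +ₛ []      = x ∷ p
    (x ∷ p) +ₛ (y ∷ r) = (x :+ y) ∷ (p +ₛ r)

    _·ₛ_ : Polynomial n → Polₛ → Polₛ
    x ·ₛ []      = []
    x ·ₛ (y ∷ p) = (x :* y) ∷ (x ·ₛ p)

    _*ₛ_ : Polₛ → Polₛ → Polₛ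
    []      *ₛ r = []
    (x ∷ p) *ₛ r = (x ·ₛ r) +ₛ (con 0 ∷ (p *ₛ r))

    _^ₛ_ : Polₛ → ℕ → Polₛ
    p ^ₛ zero  = con 1 ∷ []
    p ^ₛ suc k = p *ₛ (p ^ₛ k)

    hsubstₛ : ℕ → Polₛ → Polₛ → Polₛ → Polₛ
    hsubstₛ m p r s = go 0 p
      where
      go : ℕ → Polₛ → Polₛ
      go i []      = []
      go i (x ∷ p) = (x ·ₛ ((r ^ₛ i) *ₛ (s ^ₛ (m ∸ i)))) +ₛ go (suc i) p

    coeffₛ : Polₛ → ℕ → Polynomial n
    coeffₛ []      _       = con 0
    coeffₛ (x ∷ p) zero    = x
    coeffₛ (x ∷ p) (suc i) = coeffₛ p i

    linₛ : Polynomial n → Polynomial n → Polₛ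
    linₛ a b = b ∷ a ∷ []

    cubicₛ : Polynomial n → Polₛ
    cubicₛ t = t ∷ con 0 ∷ con 1 ∷ con 1 ∷ []

    Xₛ : Polₛ
    Xₛ = con 0 ∷ con 1 ∷ []

    fₜ∘φ-numₛ : (t α β γ δ : Polynomial n) → Polₛ
    fₜ∘φ-numₛ t α β γ δ = hsubstₛ 3 (cubicₛ t) (linₛ α β) (linₛ γ δ)

    fₜ∘φ-denₛ : (α β γ δ : Polynomial n) → Polₛ
    fₜ∘φ-denₛ α β γ δ = hsubstₛ 3 Xₛ (linₛ α β) (linₛ γ δ)

  open Syntax

  -- precomp homogenises with exponent max (length N) (length D) = 4, one more than
  -- the degree of ψ ∘ fₜ, hence the extra factor γX + δ on both sides.
  unfold-equivalence :
    ∀ (1≉0 : ¬ 1# ≈ 0#) ψ φ t u → fₜ 1≉0 u ≈ᵣ' precomp (postcomp ψ (fₜ 1≉0 t)) φ →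
    let P = fₜ∘φ-num t (a φ) (b φ) (c' φ) (d φ)
        Q = fₜ∘φ-den (a φ) (b φ) (c' φ) (d φ)
    in (lin (c' φ) (d φ) *ₚ (cubic u *ₚ (c' ψ ·ₚ P +ₚ d ψ ·ₚ Q)))
       ≈ₚ (lin (c' φ) (d φ) *ₚ ((a ψ ·ₚ P +ₚ b ψ ·ₚ Q) *ₚ X))
  unfold-equivalence 1≉0 ψ φ t u eq = coefficientwise
    where
    P Q : Pol
    P = fₜ∘φ-num t (a φ) (b φ) (c' φ) (d φ)
    Q = fₜ∘φ-den (a φ) (b φ) (c' φ) (d φ)
    ρ : Vec Carrier 10
    ρ = a ψ ∷ b ψ ∷ c' ψ ∷ d ψ ∷ a φ ∷ b φ ∷ c' φ ∷ d φ ∷ t ∷ u ∷ []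
    `a `b `c `d `α `β `γ `δ `t `u : Polynomial 10
    `a = var (# 0); `b = var (# 1); `c = var (# 2); `d = var (# 3); `α = var (# 4)
    `β = var (# 5); `γ = var (# 6); `δ = var (# 7); `t = var (# 8); `u = var (# 9)
    `ψ∘fₜ∘φ : Polₛ → Polₛ
    `ψ∘fₜ∘φ p = hsubstₛ 4 p (linₛ `α `β) (linₛ `γ `δ)
    `P `Q `lhs `lhs′ `rhs `rhs′ : Polₛ
    `P    = fₜ∘φ-numₛ `t `α `β `γ `δ
    `Q    = fₜ∘φ-denₛ `α `β `γ `δ
    `lhs  = linₛ `γ `δ *ₛ (cubicₛ `u *ₛ (`c ·ₛ `P +ₛ `d ·ₛ `Q))
    `lhs′ = cubicₛ `u *ₛ `ψ∘fₜ∘φ (`c ·ₛ cubicₛ `t +ₛ `d ·ₛ Xₛ)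
    `rhs′ = `ψ∘fₜ∘φ (`a ·ₛ cubicₛ `t +ₛ `b ·ₛ Xₛ) *ₛ Xₛ
    `rhs  = linₛ `γ `δ *ₛ ((`a ·ₛ `P +ₛ `b ·ₛ `Q) *ₛ Xₛ)

    by-normalising : ∀ k → ⟦ coeffₛ `lhs′ k ⟧ ρ ≈ ⟦ coeffₛ `rhs′ k ⟧ ρ →
                     ⟦ coeffₛ `lhs k ⟧↓ ρ ≈ ⟦ coeffₛ `lhs′ k ⟧↓ ρ →
                     ⟦ coeffₛ `rhs′ k ⟧↓ ρ ≈ ⟦ coeffₛ `rhs k ⟧↓ ρ →
                     ⟦ coeffₛ `lhs k ⟧ ρ ≈ ⟦ coeffₛ `rhs k ⟧ ρ
    by-normalising k eqₖ lhs≈lhs′ rhs′≈rhs =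
      trans (prove ρ (coeffₛ `lhs k) (coeffₛ `lhs′ k) lhs≈lhs′)
            (trans eqₖ (prove ρ (coeffₛ `rhs′ k) (coeffₛ `rhs k) rhs′≈rhs))

    coefficientwise : (lin (c' φ) (d φ) *ₚ (cubic u *ₚ (c' ψ ·ₚ P +ₚ d ψ ·ₚ Q)))
                      ≈ₚ (lin (c' φ) (d φ) *ₚ ((a ψ ·ₚ P +ₚ b ψ ·ₚ Q) *ₚ X))
    coefficientwise 0 = by-normalising 0 (eq 0) refl refl
    coefficientwise 1 = by-normalising 1 (eq 1) refl refl
    coefficientwise 2 = by-normalising 2 (eq 2) refl refl
    coefficientwise 3 = by-normalising 3 (eq 3) refl refl
    coefficientwise 4 = by-normalising 4 (eq 4) refl refl
    coefficientwise 5 = by-normalising 5 (eq 5) refl refl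
    coefficientwise 6 = by-normalising 6 (eq 6) refl refl
    coefficientwise 7 = by-normalising 7 (eq 7) refl refl
    coefficientwise (suc (suc (suc (suc (suc (suc (suc (suc k)))))))) = refl  -- both sides have degree 7

  module _ (inverse : ∀ x → ¬ x ≈ 0# → ∃[ y ] x * y ≈ 1#) where

    *-cancelˡ-nonZero : AlmostLeftCancellative 0# _*_
    *-cancelˡ-nonZero x y z x≉0 xy≈xz with inverse x x≉0
    ... | x⁻¹ , xx⁻¹≈1 = begin
      y              ≈⟨ undo y ⟨
      x⁻¹ * (x * y)  ≈⟨ *-congˡ xy≈xz ⟩
      x⁻¹ * (x * z)  ≈⟨ undo z ⟩
      z              ∎
      where
      undo : ∀ w → x⁻¹ * (x * w) ≈ w
      undo w = begin
        x⁻¹ * (x * w)  ≈⟨ solve 3 (λ x x⁻¹ w → x⁻¹ :* (x :* w) := x :* x⁻¹ :* w) refl x x⁻¹ w ⟩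
        x * x⁻¹ * w    ≈⟨ *-congʳ xx⁻¹≈1 ⟩
        1# * w         ≈⟨ *-identityˡ w ⟩
        w              ∎

    x≉0∧y≉0⇒xy≉0 : ∀ {x y} → ¬ x ≈ 0# → ¬ y ≈ 0# → ¬ x * y ≈ 0#
    x≉0∧y≉0⇒xy≉0 {x} x≉0 y≉0 xy≈0 =
      y≉0 (*-cancelˡ-nonZero x _ _ x≉0 (trans xy≈0 (sym (zeroʳ x))))

    px+qy≈py+qx⇒x≈y : ∀ {p q x y} → ¬ p ≈ q → p * x + q * y ≈ p * y + q * x → x ≈ y
    px+qy≈py+qx⇒x≈y {p} {q} {x} {y} p≉q eq =
      *-cancelˡ-nonZero (p - q) x y (p≉q ∘ x∙y⁻¹≈ε⇒x≈y p q)
        (∙-cancelʳ (q * x + q * y) _ _ (begin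
          (p - q) * x + (q * x + q * y)  ≈⟨ expand x y ⟩
          p * x + q * y                  ≈⟨ eq ⟩
          p * y + q * x                  ≈⟨ expand y x ⟨
          (p - q) * y + (q * y + q * x)  ≈⟨ +-congˡ (+-comm _ _) ⟩
          (p - q) * y + (q * x + q * y)  ∎))
      where
      expand : ∀ v w → (p - q) * v + (q * v + q * w) ≈ p * v + q * w
      expand v w = begin
        (p - q) * v + (q * v + q * w)
          ≈⟨ solve 4 (λ r q v w → r :* v :+ (q :* v :+ q :* w) := (r :+ q) :* v :+ q :* w)
                     refl (p - q) q v w ⟩
        (p - q + q) * v + q * w
          ≈⟨ +-congʳ (*-congʳ (//-rightDividesˡ q p)) ⟩
        p * v + q * w
          ∎

    nonsingular-injective : ∀ {a b c d x y x′ y′} → ¬ a * d ≈ b * c →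
                            a * x + b * y ≈ a * x′ + b * y′ → c * x + d * y ≈ c * x′ + d * y′ →
                            x ≈ x′ × y ≈ y′
    nonsingular-injective det eq₁ eq₂ =
      first det eq₁ eq₂ , first (det ∘ sym) (swap eq₁) (swap eq₂)
      where
      swap : ∀ {a b x y x′ y′} → a * x + b * y ≈ a * x′ + b * y′ →
             b * y + a * x ≈ b * y′ + a * x′
      swap eq = trans (+-comm _ _) (trans eq (+-comm _ _))
      first : ∀ {a b c d x y x′ y′} → ¬ a * d ≈ b * c →
              a * x + b * y ≈ a * x′ + b * y′ → c * x + d * y ≈ c * x′ + d * y′ → x ≈ x′
      first {a} {b} {c} {d} {x} {y} {x′} {y′} det eq₁ eq₂ =
        px+qy≈py+qx⇒x≈y det
          (x+b≈y+a⇒x≈y (*-congˡ eq₁ ⟨+⟩ *-congˡ (sym eq₂))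
            (solve 8 (λ a b c d x y x′ y′ →
                 a :* d :* x :+ b :* c :* x′ :+ (d :* (a :* x′ :+ b :* y′) :+ b :* (c :* x :+ d :* y))
              := a :* d :* x′ :+ b :* c :* x :+ (d :* (a :* x :+ b :* y) :+ b :* (c :* x′ :+ d :* y′)))
              refl a b c d x y x′ y′))

    InSpan-of-quotient : ∀ {u n₀ n₁ n₂ n₃ d₀ d₁ d₂ d₃} → ¬ u ≈ 0# →
      let N = n₀ ∷ n₁ ∷ n₂ ∷ n₃ ∷ []
          D = d₀ ∷ d₁ ∷ d₂ ∷ d₃ ∷ []
      in (cubic u *ₚ D) ≈ₚ (N *ₚ X) → InSpan u N × InSpan u D
    InSpan-of-quotient {u} {n₀} {n₁} {n₂} {n₃} {d₀} {d₁} {d₂} {d₃} u≉0 eq =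
      record { coeff₃≈coeff₂ = trans n₃≈d₁ d₁≈n₂ ; coeff₀≈u*coeff₃ = n₀≈u*n₃ } ,
      record { coeff₃≈coeff₂ = trans d₃≈0 (sym d₂≈0) ; coeff₀≈u*coeff₃ = d₀≈u*d₃ }
      where
      N D : Pol
      N = n₀ ∷ n₁ ∷ n₂ ∷ n₃ ∷ []
      D = d₀ ∷ d₁ ∷ d₂ ∷ d₃ ∷ []
      ρ : Vec Carrier 9
      ρ = u ∷ n₀ ∷ n₁ ∷ n₂ ∷ n₃ ∷ d₀ ∷ d₁ ∷ d₂ ∷ d₃ ∷ []
      `u `n₀ `n₁ `n₂ `n₃ `d₀ `d₁ `d₂ `d₃ : Polynomial 9
      `u = var (# 0); `n₀ = var (# 1); `n₁ = var (# 2); `n₂ = var (# 3); `n₃ = var (# 4)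
      `d₀ = var (# 5); `d₁ = var (# 6); `d₂ = var (# 7); `d₃ = var (# 8)
      `lhs `rhs : Polₛ
      `lhs = cubicₛ `u *ₛ (`d₀ ∷ `d₁ ∷ `d₂ ∷ `d₃ ∷ [])
      `rhs = (`n₀ ∷ `n₁ ∷ `n₂ ∷ `n₃ ∷ []) *ₛ Xₛ

      d₃≈0 : d₃ ≈ 0#
      d₃≈0 = begin
        d₃                      ≈⟨ prove ρ `d₃ (coeffₛ `lhs 6) refl ⟩
        coeff (cubic u *ₚ D) 6  ≈⟨ eq 6 ⟩
        coeff (N *ₚ X) 6        ≈⟨ prove ρ (coeffₛ `rhs 6) (con 0) refl ⟩
        0#                      ∎
      d₂≈0 : d₂ ≈ 0#
      d₂≈0 = begin
        d₂                      ≈⟨ +-identityˡ d₂ ⟨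
        0# + d₂                 ≈⟨ +-congʳ d₃≈0 ⟨
        d₃ + d₂                 ≈⟨ prove ρ (`d₃ :+ `d₂) (coeffₛ `lhs 5) refl ⟩
        coeff (cubic u *ₚ D) 5  ≈⟨ eq 5 ⟩
        coeff (N *ₚ X) 5        ≈⟨ prove ρ (coeffₛ `rhs 5) (con 0) refl ⟩
        0#                      ∎
      d₀≈0 : d₀ ≈ 0#
      d₀≈0 = *-cancelˡ-nonZero u d₀ 0# u≉0 (begin
        u * d₀                  ≈⟨ prove ρ (`u :* `d₀) (coeffₛ `lhs 0) refl ⟩
        coeff (cubic u *ₚ D) 0  ≈⟨ eq 0 ⟩
        coeff (N *ₚ X) 0        ≈⟨ prove ρ (coeffₛ `rhs 0) (`u :* con 0) refl ⟩
        u * 0#                  ∎)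
      d₀≈u*d₃ : d₀ ≈ u * d₃
      d₀≈u*d₃ = trans d₀≈0 (sym (trans (*-congˡ d₃≈0) (zeroʳ u)))
      n₃≈d₁ : n₃ ≈ d₁
      n₃≈d₁ = begin
        n₃                      ≈⟨ prove ρ (coeffₛ `rhs 4) `n₃ refl ⟨
        coeff (N *ₚ X) 4        ≈⟨ eq 4 ⟨
        coeff (cubic u *ₚ D) 4  ≈⟨ prove ρ (coeffₛ `lhs 4) (`d₂ :+ `d₁) refl ⟩
        d₂ + d₁                 ≈⟨ +-congʳ d₂≈0 ⟩
        0# + d₁                 ≈⟨ +-identityˡ d₁ ⟩
        d₁                      ∎
      d₁≈n₂ : d₁ ≈ n₂
      d₁≈n₂ = begin
        d₁                      ≈⟨ prove ρ `d₁ (`u :* con 0 :+ `d₁ :+ con 0) refl ⟩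
        u * 0# + d₁ + 0#        ≈⟨ +-cong (+-congʳ (*-congˡ d₃≈0)) d₀≈0 ⟨
        u * d₃ + d₁ + d₀        ≈⟨ prove ρ (`u :* `d₃ :+ `d₁ :+ `d₀) (coeffₛ `lhs 3) refl ⟩
        coeff (cubic u *ₚ D) 3  ≈⟨ eq 3 ⟩
        coeff (N *ₚ X) 3        ≈⟨ prove ρ (coeffₛ `rhs 3) `n₂ refl ⟩
        n₂                      ∎
      n₀≈u*n₃ : n₀ ≈ u * n₃
      n₀≈u*n₃ = begin
        n₀                      ≈⟨ prove ρ (coeffₛ `rhs 1) `n₀ refl ⟨
        coeff (N *ₚ X) 1        ≈⟨ eq 1 ⟨
        coeff (cubic u *ₚ D) 1  ≈⟨ prove ρ (coeffₛ `lhs 1) (`u :* `d₁) refl ⟩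
        u * d₁                  ≈⟨ *-congˡ n₃≈d₁ ⟨
        u * n₃                  ∎

    InSpan-nonsingular : ∀ {u a b c d} p r → ¬ a * d ≈ b * c →
                         InSpan u (a ·ₚ p +ₚ b ·ₚ r) → InSpan u (c ·ₚ p +ₚ d ·ₚ r) →
                         InSpan u p × InSpan u r
    InSpan-nonsingular {u} {a} {b} {c} {d} p r det spanN spanD =
      record { coeff₃≈coeff₂ = proj₁ top ; coeff₀≈u*coeff₃ = proj₁ bottom } ,
      record { coeff₃≈coeff₂ = proj₂ top ; coeff₀≈u*coeff₃ = proj₂ bottom }
      where
      open InSpan
      same-coeffs : ∀ x y i j → coeff (x ·ₚ p +ₚ y ·ₚ r) i ≈ coeff (x ·ₚ p +ₚ y ·ₚ r) j →
                    x * coeff p i + y * coeff r i ≈ x * coeff p j + y * coeff r j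
      same-coeffs x y i j eq =
        trans (sym (coeff-lincomb x y p r i)) (trans eq (coeff-lincomb x y p r j))
      scaled-coeffs : ∀ x y → coeff (x ·ₚ p +ₚ y ·ₚ r) 0 ≈ u * coeff (x ·ₚ p +ₚ y ·ₚ r) 3 →
                      x * coeff p 0 + y * coeff r 0 ≈ x * (u * coeff p 3) + y * (u * coeff r 3)
      scaled-coeffs x y eq = begin
        x * coeff p 0 + y * coeff r 0              ≈⟨ coeff-lincomb x y p r 0 ⟨
        coeff (x ·ₚ p +ₚ y ·ₚ r) 0                 ≈⟨ eq ⟩
        u * coeff (x ·ₚ p +ₚ y ·ₚ r) 3             ≈⟨ *-congˡ (coeff-lincomb x y p r 3) ⟩
        u * (x * coeff p 3 + y * coeff r 3)
          ≈⟨ solve 5 (λ u x y p₃ r₃ → u :* (x :* p₃ :+ y :* r₃) := x :* (u :* p₃) :+ y :* (u :* r₃))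
                     refl u x y (coeff p 3) (coeff r 3) ⟩
        x * (u * coeff p 3) + y * (u * coeff r 3)  ∎
      top : coeff p 3 ≈ coeff p 2 × coeff r 3 ≈ coeff r 2
      top = nonsingular-injective det (same-coeffs a b 3 2 (coeff₃≈coeff₂ spanN))
                                      (same-coeffs c d 3 2 (coeff₃≈coeff₂ spanD))
      bottom : coeff p 0 ≈ u * coeff p 3 × coeff r 0 ≈ u * coeff r 3
      bottom = nonsingular-injective det (scaled-coeffs a b (coeff₀≈u*coeff₃ spanN))
                                         (scaled-coeffs c d (coeff₀≈u*coeff₃ spanD))

    module _ (_≟_ : Decidable _≈_) where

      lin-*ₚ-cancelˡ : ∀ {γ δ} p r → ¬ lin γ δ ≈ₚ [] →
                       (lin γ δ *ₚ p) ≈ₚ (lin γ δ *ₚ r) → p ≈ₚ r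
      lin-*ₚ-cancelˡ {γ} {δ} p r lin≉0 eq with δ ≟ 0#
      ... | no δ≉0 = bottom-up
        where
        bottom-up : p ≈ₚ r
        shifted : ∀ i → coeff (0# ∷ p) i ≈ coeff (0# ∷ r) i
        shifted zero    = refl
        shifted (suc i) = bottom-up i
        bottom-up i = *-cancelˡ-nonZero δ _ _ δ≉0 (∙-cancelʳ _ _ _ (begin
          δ * coeff p i + γ * coeff (0# ∷ r) i  ≈⟨ +-congˡ (*-congˡ (shifted i)) ⟨
          δ * coeff p i + γ * coeff (0# ∷ p) i  ≈⟨ coeff-lin-*ₚ γ δ p i ⟨
          coeff (lin γ δ *ₚ p) i                ≈⟨ eq i ⟩
          coeff (lin γ δ *ₚ r) i                ≈⟨ coeff-lin-*ₚ γ δ r i ⟩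
          δ * coeff r i + γ * coeff (0# ∷ r) i  ∎))
      ... | yes δ≈0 = via-next-coefficient
        where
        δ*≈0 : ∀ x → δ * x ≈ 0#
        δ*≈0 x = trans (*-congʳ δ≈0) (zeroˡ x)
        γ≉0 : ¬ γ ≈ 0#
        γ≉0 γ≈0 = lin≉0 λ { zero → δ≈0 ; (suc zero) → γ≈0 ; (suc (suc i)) → refl }
        via-next-coefficient : p ≈ₚ r
        via-next-coefficient i = *-cancelˡ-nonZero γ _ _ γ≉0 (begin
          γ * coeff p i                        ≈⟨ +-identityˡ _ ⟨
          0# + γ * coeff p i                   ≈⟨ +-congʳ (δ*≈0 _) ⟨
          δ * coeff p (suc i) + γ * coeff p i  ≈⟨ coeff-lin-*ₚ γ δ p (suc i) ⟨
          coeff (lin γ δ *ₚ p) (suc i)         ≈⟨ eq (suc i) ⟩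
          coeff (lin γ δ *ₚ r) (suc i)         ≈⟨ coeff-lin-*ₚ γ δ r (suc i) ⟩
          δ * coeff r (suc i) + γ * coeff r i  ≈⟨ +-congʳ (δ*≈0 _) ⟩
          0# + γ * coeff r i                   ≈⟨ +-identityˡ _ ⟩
          γ * coeff r i                        ∎)

      module _ {t u α β γ δ : Carrier} (det : ¬ α * δ ≈ β * γ)
               (spanP : InSpan u (fₜ∘φ-num t α β γ δ))
               (spanQ : InSpan u (fₜ∘φ-den α β γ δ)) where

        private
          ρ : Vec Carrier 6
          ρ = α ∷ β ∷ γ ∷ δ ∷ t ∷ u ∷ []
          `α `β `γ `δ `t `u : Polynomial 6
          `α = var (# 0); `β = var (# 1); `γ = var (# 2)
          `δ = var (# 3); `t = var (# 4); `u = var (# 5)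
          `P `Q : Polₛ
          `P = fₜ∘φ-numₛ `t `α `β `γ `δ
          `Q = fₜ∘φ-denₛ `α `β `γ `δ
          P Q : Pol
          P = fₜ∘φ-num t α β γ δ
          Q = fₜ∘φ-den α β γ δ
          P₃≈P₂ : coeff P 3 ≈ coeff P 2
          P₃≈P₂ = InSpan.coeff₃≈coeff₂ spanP
          P₀≈uP₃ : coeff P 0 ≈ u * coeff P 3
          P₀≈uP₃ = InSpan.coeff₀≈u*coeff₃ spanP
          Q₃≈Q₂ : coeff Q 3 ≈ coeff Q 2
          Q₃≈Q₂ = InSpan.coeff₃≈coeff₂ spanQ
          Q₀≈uQ₃ : coeff Q 0 ≈ u * coeff Q 3
          Q₀≈uQ₃ = InSpan.coeff₀≈u*coeff₃ spanQ

        γ≈0⇒t≈u : γ ≈ 0# → t ≈ u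
        γ≈0⇒t≈u γ≈0 =
          *-cancelˡ-nonZero (δ * δ * δ) t u (x≉0∧y≉0⇒xy≉0 (x≉0∧y≉0⇒xy≉0 δ≉0 δ≉0) δ≉0)
            (x+b≈y+a⇒x≈y (P₀≈uP₃
                ⟨+⟩ *-congˡ α≈δ
                ⟨+⟩ *-congˡ (sym β≈0)
                ⟨+⟩ *-congˡ γ≈0)
               (prove ρ (`δ :* `δ :* `δ :* `t
                       :+ (`u :* coeffₛ `P 3
                          :+ (`α :^ 2 :* `u :+ `α :* `δ :* `u :+ `δ :^ 2 :* `u) :* `δ
                          :+ (`β :^ 2 :+ `β :* `δ) :* `β
                          :+ (`α :^ 2 :* `u :+ `γ :^ 2 :* `t :* `u) :* con 0))
                      (`δ :* `δ :* `δ :* `u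
                       :+ (coeffₛ `P 0
                          :+ (`α :^ 2 :* `u :+ `α :* `δ :* `u :+ `δ :^ 2 :* `u) :* `α
                          :+ (`β :^ 2 :+ `β :* `δ) :* con 0
                          :+ (`α :^ 2 :* `u :+ `γ :^ 2 :* `t :* `u) :* `γ)) refl))
          where
          αδ≉0 : ¬ α * δ ≈ 0#
          αδ≉0 αδ≈0 = det (trans αδ≈0 (sym (trans (*-congˡ γ≈0) (zeroʳ β))))
          α≉0 : ¬ α ≈ 0#
          α≉0 α≈0 = αδ≉0 (trans (*-congʳ α≈0) (zeroˡ δ))
          δ≉0 : ¬ δ ≈ 0#
          δ≉0 δ≈0 = αδ≉0 (trans (*-congˡ δ≈0) (zeroʳ α))
          β≈0 : β ≈ 0#
          β≈0 = *-cancelˡ-nonZero (δ * δ) β 0# (x≉0∧y≉0⇒xy≉0 δ≉0 δ≉0)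
            (x+b≈y+a⇒x≈y (Q₀≈uQ₃ ⟨+⟩ *-congˡ γ≈0)
               (prove ρ (`δ :* `δ :* `β
                       :+ (`u :* coeffₛ `Q 3
                          :+ `α :* `γ :* `u :* con 0))
                      (`δ :* `δ :* con 0
                       :+ (coeffₛ `Q 0
                          :+ `α :* `γ :* `u :* `γ)) refl))
          α≈δ : α ≈ δ
          α≈δ = *-cancelˡ-nonZero (α * α) α δ (x≉0∧y≉0⇒xy≉0 α≉0 α≉0)
            (x+b≈y+a⇒x≈y (P₃≈P₂
                ⟨+⟩ *-congˡ γ≈0
                ⟨+⟩ *-congˡ (sym γ≈0)
                ⟨+⟩ *-congˡ β≈0)
               (prove ρ (`α :* `α :* `α
                       :+ (coeffₛ `P 2
                          :+ con 3 :* `γ :* `δ :* `t :* con 0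
                          :+ (`α :^ 2 :+ `γ :^ 2 :* `t) :* `γ
                          :+ (con 3 :* `α :^ 2 :+ con 2 :* `α :* `γ) :* con 0))
                      (`α :* `α :* `δ
                       :+ (coeffₛ `P 3
                          :+ con 3 :* `γ :* `δ :* `t :* `γ
                          :+ (`α :^ 2 :+ `γ :^ 2 :* `t) :* con 0
                          :+ (con 3 :* `α :^ 2 :+ con 2 :* `α :* `γ) :* `β)) refl))

        γ≉0⇒t≈u : ¬ γ ≈ 0# → t ≈ u
        γ≉0⇒t≈u γ≉0 =
          *-cancelˡ-nonZero (γ * γ * γ) t u (x≉0∧y≉0⇒xy≉0 (x≉0∧y≉0⇒xy≉0 γ≉0 γ≉0) γ≉0)
            (x+b≈y+a⇒x≈y (tγ³≈α²[2α+γ]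
                ⟨+⟩ γδ²≈uγ³+2δ³
                ⟨+⟩ *-congˡ α+δ≈0
                ⟨+⟩ *-congˡ (sym α+δ≈0))
               (prove ρ (`γ :* `γ :* `γ :* `t
                       :+ (((`α :+ `α :+ `γ) :* (`α :* `α))
                          :+ (`u :* (`γ :* `γ :* `γ) :+ (`δ :+ `δ) :* (`δ :* `δ))
                          :+ (con 2 :* `α :^ 2 :+ `α :* `γ :+ con 2 :* `δ :^ 2) :* con 0
                          :+ (con 2 :* `α :* `δ :+ `γ :* `δ) :* (`α :+ `δ)))
                      (`γ :* `γ :* `γ :* `u
                       :+ (`t :* (`γ :* `γ :* `γ)
                          :+ `γ :* (`δ :* `δ)
                          :+ (con 2 :* `α :^ 2 :+ `α :* `γ :+ con 2 :* `δ :^ 2) :* (`α :+ `δ)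
                          :+ (con 2 :* `α :* `δ :+ `γ :* `δ) :* con 0)) refl))
          where
          αγ≈2αδ+βγ : α * γ ≈ α * (δ + δ) + β * γ
          αγ≈2αδ+βγ = *-cancelˡ-nonZero γ _ _ γ≉0
            (x+b≈y+a⇒x≈y Q₃≈Q₂
               (prove ρ (`γ :* (`α :* `γ)
                       :+ coeffₛ `Q 2)
                      (`γ :* (`α :* (`δ :+ `δ) :+ `β :* `γ)
                       :+ coeffₛ `Q 3) refl))
          -- Given αγ = 2αδ + βγ, the determinant αδ − βγ of φ equals α(3δ − γ).
          degenerate : α * γ ≈ α * (δ + δ + δ) → α * δ ≈ β * γ
          degenerate αγ≈3αδ =
            x+b≈y+a⇒x≈y (αγ≈2αδ+βγ ⟨+⟩ sym αγ≈3αδ)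
              (prove ρ (`α :* `δ
                      :+ ((`α :* (`δ :+ `δ) :+ `β :* `γ)
                         :+ `α :* `γ))
                     (`β :* `γ
                      :+ (`α :* `γ
                         :+ (`α :* (`δ :+ `δ :+ `δ)))) refl)
          α≉0 : ¬ α ≈ 0#
          α≉0 α≈0 = det (degenerate (trans (α*≈0 γ) (sym (α*≈0 (δ + δ + δ)))))
            where
            α*≈0 : ∀ x → α * x ≈ 0#
            α*≈0 x = trans (*-congʳ α≈0) (zeroˡ x)
          γ≉3δ : ¬ γ ≈ δ + δ + δ
          γ≉3δ γ≈3δ = det (degenerate (*-congˡ γ≈3δ))
          γδ²≈uγ³+2δ³ : γ * (δ * δ) ≈ u * (γ * γ * γ) + (δ + δ) * (δ * δ)
          γδ²≈uγ³+2δ³ = *-cancelˡ-nonZero α _ _ α≉0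
            (x+b≈y+a⇒x≈y (*-congˡ αγ≈2αδ+βγ ⟨+⟩ *-congˡ Q₀≈uQ₃)
               (prove ρ (`α :* (`γ :* (`δ :* `δ))
                       :+ (`δ :^ 2 :* (`α :* (`δ :+ `δ) :+ `β :* `γ)
                          :+ `γ :* (`u :* coeffₛ `Q 3)))
                      (`α :* (`u :* (`γ :* `γ :* `γ) :+ (`δ :+ `δ) :* (`δ :* `δ))
                       :+ (`δ :^ 2 :* (`α :* `γ)
                          :+ `γ :* coeffₛ `Q 0)) refl))
          tγ³≈α²[2α+γ] : t * (γ * γ * γ) ≈ (α + α + γ) * (α * α)
          tγ³≈α²[2α+γ] = px+qy≈py+qx⇒x≈y γ≉3δ
            (x+b≈y+a⇒x≈y (*-congˡ P₃≈P₂ ⟨+⟩ *-congˡ (sym αγ≈2αδ+βγ))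
               (prove ρ (`γ :* (`t :* (`γ :* `γ :* `γ)) :+ (`δ :+ `δ :+ `δ) :* ((`α :+ `α :+ `γ) :* (`α :* `α))
                       :+ (`γ :* coeffₛ `P 2
                          :+ (con 3 :* `α :^ 2 :+ con 2 :* `α :* `γ) :* (`α :* `γ)))
                      (`γ :* ((`α :+ `α :+ `γ) :* (`α :* `α)) :+ (`δ :+ `δ :+ `δ) :* (`t :* (`γ :* `γ :* `γ))
                       :+ (`γ :* coeffₛ `P 3
                          :+ (con 3 :* `α :^ 2 :+ con 2 :* `α :* `γ) :* (`α :* (`δ :+ `δ) :+ `β :* `γ))) refl))
          Z : Carrier
          Z = α * α * γ * (α + δ)
          `Z : Polynomial 6
          `Z = `α :* `α :* `γ :* (`α :+ `δ)
          -- γ³ (P₀ − u P₃), once βγ, tγ³ and uγ³ are eliminated with the three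
          -- relations above, is α²γ(α + δ)(γ − 3δ)² = (γ − 3δ)² Z.
          γZ≈3δZ : γ * Z ≈ (δ + δ + δ) * Z
          γZ≈3δZ = px+qy≈py+qx⇒x≈y γ≉3δ
            (x+b≈y+a⇒x≈y (*-congˡ P₀≈uP₃
                ⟨+⟩ *-congˡ αγ≈2αδ+βγ
                ⟨+⟩ *-congˡ (sym αγ≈2αδ+βγ)
                ⟨+⟩ *-congˡ tγ³≈α²[2α+γ]
                ⟨+⟩ *-congˡ (sym tγ³≈α²[2α+γ])
                ⟨+⟩ *-congˡ (sym γδ²≈uγ³+2δ³))
               (prove ρ (`γ :* (`γ :* `Z) :+ (`δ :+ `δ :+ `δ) :* ((`δ :+ `δ :+ `δ) :* `Z)
                       :+ (`γ :^ 3 :* (`u :* coeffₛ `P 3)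
                          :+ (`α :^ 2 :* `γ :^ 2 :+ con 4 :* `α :^ 2 :* `δ :^ 2
                                 :+ `α :* `β :* `γ :^ 2 :+ `α :* `γ :^ 2 :* `δ :+ `β :^ 2 :* `γ :^ 2
                                 :+ `β :* `γ :^ 2 :* `δ) :* (`α :* (`δ :+ `δ) :+ `β :* `γ)
                          :+ (con 4 :* `α :^ 2 :* `γ :* `δ :+ con 2 :* `α :* `β :* `γ :* `δ
                                 :+ con 2 :* `α :* `γ :* `δ :^ 2) :* (`α :* `γ)
                          :+ `γ :* `δ :^ 2 :* ((`α :+ `α :+ `γ) :* (`α :* `α))
                          :+ con 3 :* `δ :^ 3 :* (`t :* (`γ :* `γ :* `γ))
                          :+ (`α :^ 3 :+ `α :^ 2 :* `γ :+ `γ :^ 3 :* `t) :* (`γ :* (`δ :* `δ))))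
                      (`γ :* ((`δ :+ `δ :+ `δ) :* `Z) :+ (`δ :+ `δ :+ `δ) :* (`γ :* `Z)
                       :+ (`γ :^ 3 :* coeffₛ `P 0
                          :+ (`α :^ 2 :* `γ :^ 2 :+ con 4 :* `α :^ 2 :* `δ :^ 2
                                 :+ `α :* `β :* `γ :^ 2 :+ `α :* `γ :^ 2 :* `δ :+ `β :^ 2 :* `γ :^ 2
                                 :+ `β :* `γ :^ 2 :* `δ) :* (`α :* `γ)
                          :+ (con 4 :* `α :^ 2 :* `γ :* `δ :+ con 2 :* `α :* `β :* `γ :* `δ
                                 :+ con 2 :* `α :* `γ :* `δ :^ 2) :* (`α :* (`δ :+ `δ) :+ `β :* `γ)
                          :+ `γ :* `δ :^ 2 :* (`t :* (`γ :* `γ :* `γ))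
                          :+ con 3 :* `δ :^ 3 :* ((`α :+ `α :+ `γ) :* (`α :* `α))
                          :+ (`α :^ 3 :+ `α :^ 2 :* `γ :+ `γ :^ 3 :* `t) :* (`u :* (`γ :* `γ :* `γ) :+ (`δ :+ `δ) :* (`δ :* `δ)))) refl))
          Z≈0 : Z ≈ 0#
          Z≈0 = px+qy≈py+qx⇒x≈y γ≉3δ
            (x+b≈y+a⇒x≈y γZ≈3δZ
               (prove ρ (`γ :* `Z :+ (`δ :+ `δ :+ `δ) :* con 0
                       :+ ((`δ :+ `δ :+ `δ) :* `Z))
                      (`γ :* con 0 :+ (`δ :+ `δ :+ `δ) :* `Z
                       :+ `γ :* `Z) refl))
          α+δ≈0 : α + δ ≈ 0#
          α+δ≈0 = *-cancelˡ-nonZero (α * α * γ) (α + δ) 0#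
                    (x≉0∧y≉0⇒xy≉0 (x≉0∧y≉0⇒xy≉0 α≉0 α≉0) γ≉0) (trans Z≈0 (sym (zeroʳ _)))

        fₜ∘φ-InSpan⇒t≈u : t ≈ u
        fₜ∘φ-InSpan⇒t≈u with γ ≟ 0#
        ... | yes γ≈0 = γ≈0⇒t≈u γ≈0
        ... | no γ≉0  = γ≉0⇒t≈u γ≉0

proposition3p3 : {c ℓ : Level} (R : CommutativeRing c ℓ) (q : ℕ) → IsPrimePower q →
    (F : IsFiniteField R q) → (t t' : CommutativeRing.Carrier R) →
    ¬ (CommutativeRing._≈_ R t (CommutativeRing.0# R)) →
    ¬ (CommutativeRing._≈_ R t' (CommutativeRing.0# R)) →
    Poly.Equivalent R (Poly.fₜ R (IsFiniteField.1≉0 F) t) (Poly.fₜ R (IsFiniteField.1≉0 F) t') →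
    CommutativeRing._≈_ R t t'
proposition3p3 R q _ F t t' _ t'≉0 (ψ , φ , eq) =
  fₜ∘φ-InSpan⇒t≈u R inverse _≟_ (Möbius-nonsingular R φ) (proj₁ spanPQ) (proj₂ spanPQ)
  where
  open Poly R
  open IsFiniteField F using (1≉0; inverse)
  _≟_ : Decidable (CommutativeRing._≈_ R)
  _≟_ = IsFiniteField⇒≟ R F
  P Q N D : Pol
  P = fₜ∘φ-num R t (a φ) (b φ) (c' φ) (d φ)
  Q = fₜ∘φ-den R (a φ) (b φ) (c' φ) (d φ)
  N = a ψ ·ₚ P +ₚ b ψ ·ₚ Q
  D = c' ψ ·ₚ P +ₚ d ψ ·ₚ Q
  fₜ′≈N/D : (cubic R t' *ₚ D) ≈ₚ (N *ₚ X R)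
  fₜ′≈N/D = lin-*ₚ-cancelˡ R inverse _≟_ (cubic R t' *ₚ D) (N *ₚ X R)
              (Möbius-denominator≉0 R φ) (unfold-equivalence R 1≉0 ψ φ t t' eq)
  spanND : InSpan R t' N × InSpan R t' D
  spanND = InSpan-of-quotient R inverse t'≉0 fₜ′≈N/D
  spanPQ : InSpan R t' P × InSpan R t' Q
  spanPQ = InSpan-nonsingular R inverse P Q (Möbius-nonsingular R ψ)
             (proj₁ spanND) (proj₂ spanND)
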